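{- For every $n\ge1$ and every $1\le i\le m$, the set $B_n^i$ defined in the context is a $(1,1)$-guaranteed subset of $\mathcal{S}_n$ of minimum size among all $(1,1)$-guaranteed subsets of $\mathcal{S}_n$ (its size being $|\Sigma|^{n-1}$).
   Context: $\Sigma=\{c_1,\ldots,c_m\}$ is a finite alphabet with $m=|\Sigma|>1$, $\mathcal{S}_n=\Sigma^n$ with the edit (Levenshtein) distance $\mathrm{edit}$. $N_n^r(s)=\{t\in\mathcal{S}_n:\mathrm{edit}(s,t)\le r\}$. A subset $B\subset\mathcal{S}_n$ is $(d_1,r)$-guaranteed if $N_n^r(s)\cap N_n^r(t)\cap B\neq\emptyset$ for every pair $s,t\in\mathcal{S}_n$ with $\mathrm{edit}(s,t)\le d_1$. Define recursively $B_1^i=\{c_i\}$ for $1\le i\le m$, and for $n\ge2$, $B_n^i=\bigcup_{j=1}^m c_j\circ B_{n-1}^{((i+j-2)\bmod m)+1}$, where $c\circ X$ denotes the set obtained by prepending the character $c$ to each sequence of $X$ (so $c_1$ is paired with $B_{n-1}^i$, $c_2$ with $B_{n-1}^{i+1}$, and so on cyclically). -}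

module Defs where

open import Data.Nat using (ℕ; zero; suc; _+_; _≤_; _⊓_; NonZero)
open import Data.Nat.DivMod using (_mod_)
open import Data.Fin using (Fin; toℕ; _≟_)
open import Data.Bool using (Bool; true; false; if_then_else_)
open import Data.List using (List; []; _∷_; length; filter; concatMap; map)
open import Data.Vec using (Vec; []; _∷_; toList)
open import Data.Product using (∃; _×_)
open import Relation.Binary.PropositionalEquality using (_≡_)
open import Relation.Nullary.Decidable using (does)

-- Alphabet Σ = Fin m (character c_{k+1} is the Fin element k).
-- Sequences of length n: Vec (Fin m) n.

editL : ∀ {m} → List (Fin m) → List (Fin m) → ℕ
editL [] ys = length ys
editL (x ∷ xs) [] = suc (length xs)
editL (x ∷ xs) (y ∷ ys) =
  (suc (editL xs (y ∷ ys)) ⊓ suc (editL (x ∷ xs) ys))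
    ⊓ ((if does (x ≟ y) then 0 else 1) + editL xs ys)

edit : ∀ {m n} → Vec (Fin m) n → Vec (Fin m) n → ℕ
edit s t = editL (toList s) (toList t)

Subset : ℕ → ℕ → Set
Subset m n = Vec (Fin m) n → Bool

allSeqs : ∀ m n → List (Vec (Fin m) n)
allSeqs m zero = [] ∷ []
allSeqs m (suc n) = concatMap (λ c → map (c ∷_) (allSeqs m n)) (Data.List.allFin m)
  where import Data.List

card : ∀ {m n} → Subset m n → ℕ
card {m} {n} B = length (filter (λ s → Data.Bool._≟_ (B s) true) (allSeqs m n))
  where import Data.Bool

Guaranteed : ∀ {m n} → ℕ → ℕ → Subset m n → Set
Guaranteed {m} {n} d₁ r B =
  ∀ (s t : Vec (Fin m) n) → edit s t ≤ d₁ →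
  ∃ λ u → B u ≡ true × edit s u ≤ r × edit t u ≤ r

-- The sets B_n^i (0-indexed: i, j ∈ Fin m).  B_1^i = {c_i};
-- B_{n+1}^i = ⋃_j c_j ∘ B_n^{(i+j) mod m}, so a sequence c_j ∷ w lies in
-- B_{n+1}^i iff w ∈ B_n^{(i+j) mod m}.
Bset : ∀ {m} .{{_ : NonZero m}} → (n : ℕ) → Fin m → Subset m (suc n)
Bset zero i (x ∷ []) = does (x ≟ i)
Bset {m} (suc n) i (x ∷ w) = Bset n ((toℕ i + toℕ x) mod m) w

-- Between words of equal length, edit distance at most 1 means Hamming distance
-- at most 1.  Two words p a ≠ p b differing only in their last letter have common
-- neighbours only on the line p Σ, so a (1,1)-guaranteed set meets each of the
-- m^(n-1) lines p Σ and has at least m^(n-1) elements.  Unfolding the recursion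
-- (letters numbered from 0), w ∈ B_n^i iff w_n ≡ i + w_1 + ⋯ + w_{n-1} (mod m):
-- each line meets B_n^i exactly once, so |B_n^i| = m^(n-1); and if s, t differ
-- only at position k, setting that letter to the value that solves the congruence
-- gives a common neighbour of s and t in B_n^i.
module Submission where

open import Data.Bool using (Bool; true; false; if_then_else_)
import Data.Bool as Bool
open import Data.Empty using (⊥-elim)
open import Data.Fin using (Fin; toℕ; _≟_) renaming (zero to fzero; suc to fsuc)
open import Data.Fin.Properties using (toℕ-injective; toℕ<n; toℕ-fromℕ<)
open import Data.List using (List; []; _∷_; _++_; length; filter; map; tabulate; concatMap)
open import Data.List.Properties using (length-++; filter-++)
open import Data.Nat using (ℕ; zero; suc; _+_; _*_; _^_; _∸_; _⊓_; _%_; _≤_; _<_; z≤n; s≤s; NonZero)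
open import Data.Nat.DivMod using (_mod_; %-distribˡ-+; m%n%n≡m%n; [m+n]%n≡m%n; m<n⇒m%n≡m)
open import Data.Nat.Properties hiding (_≟_)
open import Algebra.Properties.CommutativeMonoid.Sum +-0-commutativeMonoid
  using (sum; sum-cong-≗; sum-remove)
open import Data.Product using (∃; _×_; _,_; proj₂)
open import Data.Sum using (_⊎_; inj₁; inj₂)
open import Data.Vec using (Vec; []; _∷_; toList; _∷ʳ_)
open import Data.Vec.Properties using (toList-injective; length-toList; ∷ʳ-injective)
open import Data.Vec.Relation.Binary.Equality.Cast using (cast-is-id)
open import Relation.Binary.PropositionalEquality
  using (_≡_; _≢_; refl; sym; trans; cong; subst; module ≡-Reasoning)
open import Relation.Nullary using (yes; no)
open import Relation.Nullary.Decidable using (does; dec-true)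

open import Defs

private
  variable
    A C : Set
    m n : ℕ

⊓≤⇒⊎ : ∀ {a b c} → a ⊓ b ≤ c → a ≤ c ⊎ b ≤ c
⊓≤⇒⊎ {a} {b} a⊓b≤c with ≤-total a b
... | inj₁ a≤b = inj₁ (subst (_≤ _) (m≤n⇒m⊓n≡m a≤b) a⊓b≤c)
... | inj₂ b≤a = inj₂ (subst (_≤ _) (m≥n⇒m⊓n≡n b≤a) a⊓b≤c)

sum-const : (m k : ℕ) → sum {m} (λ _ → k) ≡ m * k
sum-const zero    k = refl
sum-const (suc m) k = cong (k +_) (sum-const m k)

sum-mono-≤ : {f g : Fin m → ℕ} → (∀ c → f c ≤ g c) → sum f ≤ sum g
sum-mono-≤ {zero}  f≤g = z≤n
sum-mono-≤ {suc m} f≤g = +-mono-≤ (f≤g fzero) (sum-mono-≤ (λ c → f≤g (fsuc c)))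

term≤sum : (f : Fin m → ℕ) (c : Fin m) → f c ≤ sum f
term≤sum {suc m} f c = ≤-trans (m≤m+n (f c) _) (≤-reflexive (sym (sum-remove {i = c} f)))

sum-indicator : (i : Fin m) → sum (λ c → if does (c ≟ i) then 1 else 0) ≡ 1
sum-indicator {suc m} fzero    = cong suc (trans (sum-const m 0) (*-zeroʳ m))
sum-indicator {suc m} (fsuc i) = sum-indicator i

-- card B is definitionally count B (allSeqs m n).
count : (A → Bool) → List A → ℕ
count P xs = length (filter (λ x → P x Bool.≟ true) xs)

count-singleton : (P : A → Bool) (x : A) → count P (x ∷ []) ≡ (if P x then 1 else 0)
count-singleton P x with P x
... | true  = refl
... | false = refl

count-++ : (P : A → Bool) (xs ys : List A) → count P (xs ++ ys) ≡ count P xs + count P ys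
count-++ P xs ys = trans (cong length (filter-++ _ xs ys)) (length-++ (filter _ xs))

count-map : (P : A → Bool) (f : C → A) (xs : List C) →
  count P (map f xs) ≡ count (λ x → P (f x)) xs
count-map P f []       = refl
count-map P f (x ∷ xs) with P (f x)
... | true  = cong suc (count-map P f xs)
... | false = count-map P f xs

count-concatMap-tabulate : ∀ {k} (P : A → Bool) (g : Fin k → List A)
  (h : Fin m → Fin k) →
  count P (concatMap g (tabulate h)) ≡ sum (λ c → count P (g (h c)))
count-concatMap-tabulate {m = zero}  P g h = refl
count-concatMap-tabulate {m = suc m} P g h =
  trans (count-++ P (g (h fzero)) _)
        (cong (count P (g (h fzero)) +_) (count-concatMap-tabulate P g (λ c → h (fsuc c))))

card-∷ : (B : Subset m (suc n)) → card B ≡ sum (λ c → card (λ w → B (c ∷ w)))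
card-∷ {m} {n} B =
  trans (count-concatMap-tabulate B (λ c → map (c ∷_) (allSeqs m n)) (λ c → c))
        (sum-cong-≗ (λ c → count-map B (c ∷_) (allSeqs m n)))

toList-injective′ : (xs ys : Vec A n) → toList xs ≡ toList ys → xs ≡ ys
toList-injective′ xs ys e = trans (sym (cast-is-id refl xs)) (toList-injective refl xs ys e)

toList≢∷toList : (xs ys : Vec A n) (y : A) → toList xs ≢ y ∷ toList ys
toList≢∷toList {n = n} xs ys y e = m≢1+n+m n {0}
  (trans (sym (length-toList xs)) (trans (cong length e) (cong suc (length-toList ys))))

module _ {m : ℕ} where

  data Hamming≤1 : Vec (Fin m) n → Vec (Fin m) n → Set where
    []    : Hamming≤1 [] []
    here  : (a b : Fin m) (w : Vec (Fin m) n) → Hamming≤1 (a ∷ w) (b ∷ w)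
    there : (x : Fin m) {w w′ : Vec (Fin m) n} → Hamming≤1 w w′ →
            Hamming≤1 (x ∷ w) (x ∷ w′)

  Hamming≤1-∷ʳ : (p : Vec (Fin m) n) (a b : Fin m) → Hamming≤1 (p ∷ʳ a) (p ∷ʳ b)
  Hamming≤1-∷ʳ []      a b = here a b []
  Hamming≤1-∷ʳ (x ∷ p) a b = there x (Hamming≤1-∷ʳ p a b)

  Hamming≤1-∷⁻ : {x y : Fin m} {w w′ : Vec (Fin m) n} →
    Hamming≤1 (x ∷ w) (y ∷ w′) →
    w ≡ w′ ⊎ (x ≡ y × Hamming≤1 w w′)
  Hamming≤1-∷⁻ (here _ _ _) = inj₁ refl
  Hamming≤1-∷⁻ (there _ h)  = inj₂ (refl , h)

  common-neighbour-∷ʳ : (p : Vec (Fin m) n) {a b : Fin m} → a ≢ b →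
    (u : Vec (Fin m) (suc n)) → Hamming≤1 (p ∷ʳ a) u → Hamming≤1 (p ∷ʳ b) u →
    ∃ λ x → u ≡ p ∷ʳ x
  common-neighbour-∷ʳ []      a≢b (x ∷ []) _ _ = x , refl
  common-neighbour-∷ʳ (y ∷ p) {a} {b} a≢b (z ∷ u) h₁ h₂
    with Hamming≤1-∷⁻ h₁ | Hamming≤1-∷⁻ h₂
  ... | inj₁ e₁          | inj₁ e₂         =
    ⊥-elim (a≢b (proj₂ (∷ʳ-injective p p (trans e₁ (sym e₂)))))
  ... | inj₁ refl        | inj₂ (refl , _) = a , refl
  ... | inj₂ (refl , _)  | inj₁ refl       = b , refl
  ... | inj₂ (refl , g₁) | inj₂ (_ , g₂)
    with common-neighbour-∷ʳ p a≢b u g₁ g₂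
  ...   | x , refl = x , refl

module _ {m : ℕ} where

  editL-∷-≤⁻ : ∀ {k} (x y : Fin m) (xs ys : List (Fin m)) →
    editL (x ∷ xs) (y ∷ ys) ≤ k →
    suc (editL xs (y ∷ ys)) ≤ k ⊎ suc (editL (x ∷ xs) ys) ≤ k
      ⊎ (if does (x ≟ y) then 0 else 1) + editL xs ys ≤ k
  editL-∷-≤⁻ x y xs ys d with ⊓≤⇒⊎ d
  ... | inj₂ d′ = inj₂ (inj₂ d′)
  ... | inj₁ d′ with ⊓≤⇒⊎ d′
  ...   | inj₁ d″ = inj₁ d″
  ...   | inj₂ d″ = inj₂ (inj₁ d″)

  editL-∷-≤-substitute : (x y : Fin m) (xs ys : List (Fin m)) →
    editL (x ∷ xs) (y ∷ ys) ≤ (if does (x ≟ y) then 0 else 1) + editL xs ys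
  editL-∷-≤-substitute x y xs ys = m⊓n≤n _ _

  editL-∷-same : (x : Fin m) (xs ys : List (Fin m)) → editL (x ∷ xs) (x ∷ ys) ≤ editL xs ys
  editL-∷-same x xs ys with x ≟ x | editL-∷-≤-substitute x x xs ys
  ... | yes _  | d = d
  ... | no x≢x | _ = ⊥-elim (x≢x refl)

  editL-∷-diff : (x y : Fin m) (xs ys : List (Fin m)) →
    editL (x ∷ xs) (y ∷ ys) ≤ suc (editL xs ys)
  editL-∷-diff x y xs ys with x ≟ y | editL-∷-≤-substitute x y xs ys
  ... | yes _ | d = ≤-trans d (n≤1+n _)
  ... | no _  | d = d

  editL-refl : (xs : List (Fin m)) → editL xs xs ≡ 0
  editL-refl []       = refl
  editL-refl (x ∷ xs) =
    n≤0⇒n≡0 (≤-trans (editL-∷-same x xs xs) (≤-reflexive (editL-refl xs)))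

  editL≤0⇒≡ : (xs ys : List (Fin m)) → editL xs ys ≤ 0 → xs ≡ ys
  editL≤0⇒≡ []       []       _ = refl
  editL≤0⇒≡ (x ∷ xs) (y ∷ ys) d with editL-∷-≤⁻ x y xs ys d
  ... | inj₁ ()
  ... | inj₂ (inj₁ ())
  ... | inj₂ (inj₂ d′) with x ≟ y
  ...   | yes refl = cong (x ∷_) (editL≤0⇒≡ xs ys d′)
  ...   | no _ with d′
  ...     | ()

  Hamming≤1⇒edit≤1 : {s t : Vec (Fin m) n} → Hamming≤1 s t → edit s t ≤ 1
  Hamming≤1⇒edit≤1 []           = z≤n
  Hamming≤1⇒edit≤1 (here a b w) =
    ≤-trans (editL-∷-diff a b (toList w) (toList w))
            (≤-reflexive (cong suc (editL-refl (toList w))))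
  Hamming≤1⇒edit≤1 (there x {w} {w′} h) =
    ≤-trans (editL-∷-same x (toList w) (toList w′)) (Hamming≤1⇒edit≤1 h)

  edit≤1⇒Hamming≤1 : (s t : Vec (Fin m) n) → edit s t ≤ 1 → Hamming≤1 s t
  edit≤1⇒Hamming≤1 []       []       _ = []
  edit≤1⇒Hamming≤1 (x ∷ xs) (y ∷ ys) d with editL-∷-≤⁻ x y (toList xs) (toList ys) d
  -- an insertion or a deletion would leave words of different lengths at distance 0
  ... | inj₁ (s≤s d′)        = ⊥-elim (toList≢∷toList xs ys y (editL≤0⇒≡ _ _ d′))
  ... | inj₂ (inj₁ (s≤s d′)) = ⊥-elim (toList≢∷toList ys xs x (sym (editL≤0⇒≡ _ _ d′)))
  ... | inj₂ (inj₂ d′) with x ≟ y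
  ...   | yes refl = there x (edit≤1⇒Hamming≤1 xs ys d′)
  ...   | no _ with d′
  ...     | s≤s d″ with toList-injective′ xs ys (editL≤0⇒≡ _ _ d″)
  ...       | refl = here x y xs

MeetsEveryLine : Subset m (suc n) → Set
MeetsEveryLine {m} {n} B = (p : Vec (Fin m) n) → ∃ λ x → B (p ∷ʳ x) ≡ true

guaranteed⇒meetsEveryLine : {B : Subset m (suc n)} (a b : Fin m) → a ≢ b →
  Guaranteed 1 1 B → MeetsEveryLine B
guaranteed⇒meetsEveryLine a b a≢b g p
  with g (p ∷ʳ a) (p ∷ʳ b) (Hamming≤1⇒edit≤1 (Hamming≤1-∷ʳ p a b))
... | u , u∈B , d₁ , d₂
  with common-neighbour-∷ʳ p a≢b u (edit≤1⇒Hamming≤1 _ _ d₁) (edit≤1⇒Hamming≤1 _ _ d₂)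
... | x , refl = x , u∈B

meetsEveryLine⇒^≤card : (B : Subset m (suc n)) → MeetsEveryLine B → m ^ n ≤ card B
meetsEveryLine⇒^≤card {m} {zero} B meets with meets []
... | x , x∈B = begin
  1                                     ≡⟨ cong (λ b → if b then 1 else 0) x∈B ⟨
  (if B (x ∷ []) then 1 else 0)         ≡⟨ count-singleton (λ w → B (x ∷ w)) [] ⟨
  card (λ w → B (x ∷ w))                ≤⟨ term≤sum (λ c → card (λ w → B (c ∷ w))) x ⟩
  sum (λ c → card (λ w → B (c ∷ w)))    ≡⟨ card-∷ B ⟨
  card B                                ∎
  where open ≤-Reasoning
meetsEveryLine⇒^≤card {m} {suc n} B meets = begin
  m * m ^ n                             ≡⟨ sum-const m (m ^ n) ⟨
  sum {m} (λ _ → m ^ n)                 ≤⟨ sum-mono-≤ slices-meet-every-line ⟩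
  sum (λ c → card (λ w → B (c ∷ w)))    ≡⟨ card-∷ B ⟨
  card B                                ∎
  where
  open ≤-Reasoning
  slices-meet-every-line : ∀ c → m ^ n ≤ card (λ w → B (c ∷ w))
  slices-meet-every-line c = meetsEveryLine⇒^≤card _ (λ p → meets (c ∷ p))

module _ {m : ℕ} .{{_ : NonZero m}} where

  [a+x%m]%m≡[a+x]%m : ∀ a x → (a + x % m) % m ≡ (a + x) % m
  [a+x%m]%m≡[a+x]%m a x = begin
    (a + x % m) % m             ≡⟨ %-distribˡ-+ a (x % m) m ⟩
    (a % m + x % m % m) % m     ≡⟨ cong (λ y → (a % m + y) % m) (m%n%n≡m%n x m) ⟩
    (a % m + x % m) % m         ≡⟨ %-distribˡ-+ a x m ⟨
    (a + x) % m                 ∎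
    where open ≡-Reasoning

  +-mod-surjective : (a b : Fin m) → ∃ λ c → (toℕ a + toℕ c) mod m ≡ b
  +-mod-surjective a b = (toℕ b + (m ∸ toℕ a)) mod m , toℕ-injective (begin
    toℕ ((toℕ a + toℕ ((toℕ b + (m ∸ toℕ a)) mod m)) mod m)
      ≡⟨ toℕ-fromℕ< _ ⟩
    (toℕ a + toℕ ((toℕ b + (m ∸ toℕ a)) mod m)) % m
      ≡⟨ cong (λ y → (toℕ a + y) % m) (toℕ-fromℕ< _) ⟩
    (toℕ a + (toℕ b + (m ∸ toℕ a)) % m) % m
      ≡⟨ [a+x%m]%m≡[a+x]%m (toℕ a) _ ⟩
    (toℕ a + (toℕ b + (m ∸ toℕ a))) % m
      ≡⟨ cong (_% m) a+[b+[m∸a]]≡b+m ⟩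
    (toℕ b + m) % m
      ≡⟨ [m+n]%n≡m%n (toℕ b) m ⟩
    toℕ b % m
      ≡⟨ m<n⇒m%n≡m (toℕ<n b) ⟩
    toℕ b ∎)
    where
    open ≡-Reasoning
    a+[b+[m∸a]]≡b+m : toℕ a + (toℕ b + (m ∸ toℕ a)) ≡ toℕ b + m
    a+[b+[m∸a]]≡b+m = begin
      toℕ a + (toℕ b + (m ∸ toℕ a))   ≡⟨ +-comm (toℕ a) _ ⟩
      toℕ b + (m ∸ toℕ a) + toℕ a     ≡⟨ +-assoc (toℕ b) _ _ ⟩
      toℕ b + (m ∸ toℕ a + toℕ a)     ≡⟨ cong (toℕ b +_) (m∸n+n≡m (<⇒≤ (toℕ<n a))) ⟩
      toℕ b + m                       ∎

  Bset-covers : (n : ℕ) (w : Vec (Fin m) (suc n)) → ∃ λ j → Bset n j w ≡ true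
  Bset-covers zero    (x ∷ []) = x , dec-true (x ≟ x) refl
  Bset-covers (suc n) (x ∷ w) with Bset-covers n w
  ... | j , w∈Bⱼ with +-mod-surjective x j
  ...   | c , x+c≡j = c , subst (λ k → Bset n k w ≡ true) c+x≡j w∈Bⱼ
    where
    c+x≡j : j ≡ (toℕ c + toℕ x) mod m
    c+x≡j = sym (trans (cong (_mod m) (+-comm (toℕ c) (toℕ x))) x+c≡j)

  Bset-common-neighbour : (n : ℕ) (i : Fin m) {s t : Vec (Fin m) (suc n)} →
    Hamming≤1 s t →
    ∃ λ u → Bset n i u ≡ true × Hamming≤1 s u × Hamming≤1 t u
  Bset-common-neighbour zero i {a ∷ []} {b ∷ []} _ =
    i ∷ [] , dec-true (i ≟ i) refl , here a i [] , here b i []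
  Bset-common-neighbour (suc n) i (here a b w) with Bset-covers n w
  ... | j , w∈Bⱼ with +-mod-surjective i j
  ...   | c , i+c≡j =
    c ∷ w , subst (λ k → Bset n k w ≡ true) (sym i+c≡j) w∈Bⱼ , here a c w , here b c w
  Bset-common-neighbour (suc n) i (there x h)
    with Bset-common-neighbour n ((toℕ i + toℕ x) mod m) h
  ... | u , u∈B , h₁ , h₂ = x ∷ u , u∈B , there x h₁ , there x h₂

  Bset-guaranteed : (n : ℕ) (i : Fin m) → Guaranteed 1 1 (Bset n i)
  Bset-guaranteed n i s t d with Bset-common-neighbour n i (edit≤1⇒Hamming≤1 s t d)
  ... | u , u∈B , h₁ , h₂ = u , u∈B , Hamming≤1⇒edit≤1 h₁ , Hamming≤1⇒edit≤1 h₂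

  card-Bset : (n : ℕ) (i : Fin m) → card (Bset n i) ≡ m ^ n
  card-Bset zero i = begin
    card (Bset zero i)
      ≡⟨ card-∷ (Bset zero i) ⟩
    sum {m} (λ c → card (λ w → Bset zero i (c ∷ w)))
      ≡⟨ sum-cong-≗ {m} (λ c → count-singleton (λ w → Bset zero i (c ∷ w)) []) ⟩
    sum {m} (λ c → if does (c ≟ i) then 1 else 0)
      ≡⟨ sum-indicator i ⟩
    1 ∎
    where open ≡-Reasoning
  card-Bset (suc n) i = begin
    card (Bset (suc n) i)
      ≡⟨ card-∷ (Bset (suc n) i) ⟩
    sum {m} (λ c → card (Bset n ((toℕ i + toℕ c) mod m)))
      ≡⟨ sum-cong-≗ {m} (λ c → card-Bset n ((toℕ i + toℕ c) mod m)) ⟩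
    sum {m} (λ _ → m ^ n)
      ≡⟨ sum-const m (m ^ n) ⟩
    m * m ^ n ∎
    where open ≡-Reasoning

lemma10 : (m : ℕ) .{{_ : NonZero m}} → 1 < m → (n : ℕ) → (i : Fin m) →
    Guaranteed 1 1 (Bset n i)
      × (∀ (B : Subset m (suc n)) → Guaranteed 1 1 B → card (Bset n i) ≤ card B)
      × card (Bset n i) ≡ m ^ n
lemma10 (suc zero) (s≤s ()) n i
lemma10 m@(suc (suc _)) _ n i = Bset-guaranteed n i , minimal , card-Bset n i
  where
  minimal : ∀ (B : Subset m (suc n)) → Guaranteed 1 1 B → card (Bset n i) ≤ card B
  minimal B g = subst (_≤ card B) (sym (card-Bset n i))
    (meetsEveryLine⇒^≤card B (guaranteed⇒meetsEveryLine fzero (fsuc fzero) (λ ()) g))
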